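{- Let $u,v\in\{1,2,\dots,N\}$ and let $\lambda\in\mathbb{Z}_{\ge0}^4$ satisfy $a\lambda_1+b\lambda_2-c\lambda_3-d\lambda_4=v-u$. Then there is a path $\pi$ in $Q$ from $u$ to $v$ with $\mathrm{wt}(\pi)=\lambda$.
   Context: Fix positive integers $a,b,c,d$ with $a+b=c+d=N$ and $\gcd(a,c,N)=1$. The Gale–Robinson quiver $Q$ has vertex set $\{1,\dots,N\}$; for vertices $i,j$ the number of arrows $i\to j$ equals the number of the following conditions that hold: (E) $j=i+a$; (W) $j=i+b$; (S) $j=i-c$; (N) $j=i-d$; (SE) $j=i+a-c$ with $i+a>N$, $i-c<1$; (NE) $j=i+a-d$ with $i+a>N$, $i-d<1$; (SW) $j=i+b-c$ with $i+b>N$, $i-c<1$; (NW) $j=i+b-d$ with $i+b>N$, $i-d<1$. An arrow of type E, W, S, N, SE, NE, SW, NW has weight $\mathrm{wt}\in\mathbb{Z}^4$ equal to $(1,0,0,0),(0,1,0,0),(0,0,1,0),(0,0,0,1),(1,0,1,0),(1,0,0,1),(0,1,1,0),(0,1,0,1)$ respectively; the weight of a path is the sum of the weights of its arrows (a length-zero path has weight $0$). -}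

module Defs where

open import Data.Nat using (ℕ; zero; suc; _+_; _*_; _≤_; _<_)
open import Data.Product using (_×_; _,_)
open import Relation.Binary.PropositionalEquality using (_≡_)

Wt : Set
Wt = ℕ × ℕ × ℕ × ℕ

_⊕_ : Wt → Wt → Wt
(x₁ , x₂ , x₃ , x₄) ⊕ (y₁ , y₂ , y₃ , y₄) = (x₁ + y₁ , x₂ + y₂ , x₃ + y₃ , x₄ + y₄)

-- Each constructor is one arrow type; the number of arrows i → j is the
-- number of constructors whose condition holds.  Vertices are naturals
-- (the vertex range 1..N is imposed on path endpoints; arrows only ever
-- connect vertices in 1..N when the endpoints lie there and a+b=c+d=N
-- -- no: we impose it explicitly below).
-- "j = i - c" is written j + c ≡ i; "i - c < 1" is written i ≤ c;
-- "i + a > N" is written N < i + a; "j = i + a - c" is written j + c ≡ i + a.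
data Arrow (a b c d N : ℕ) (i j : ℕ) : Set where
  E  : j ≡ i + a → Arrow a b c d N i j
  W  : j ≡ i + b → Arrow a b c d N i j
  S  : j + c ≡ i → Arrow a b c d N i j
  Nn : j + d ≡ i → Arrow a b c d N i j
  SE : j + c ≡ i + a → N < i + a → i ≤ c → Arrow a b c d N i j
  NE : j + d ≡ i + a → N < i + a → i ≤ d → Arrow a b c d N i j
  SW : j + c ≡ i + b → N < i + b → i ≤ c → Arrow a b c d N i j
  NW : j + d ≡ i + b → N < i + b → i ≤ d → Arrow a b c d N i j

IsVertex : ℕ → ℕ → Set
IsVertex N i = 1 ≤ i × i ≤ N

QArrow : (a b c d N : ℕ) → ℕ → ℕ → Set
QArrow a b c d N i j = IsVertex N i × IsVertex N j × Arrow a b c d N i j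

arrowWt : ∀ {a b c d N i j} → Arrow a b c d N i j → Wt
arrowWt (E _)        = (1 , 0 , 0 , 0)
arrowWt (W _)        = (0 , 1 , 0 , 0)
arrowWt (S _)        = (0 , 0 , 1 , 0)
arrowWt (Nn _)       = (0 , 0 , 0 , 1)
arrowWt (SE _ _ _)   = (1 , 0 , 1 , 0)
arrowWt (NE _ _ _)   = (1 , 0 , 0 , 1)
arrowWt (SW _ _ _)   = (0 , 1 , 1 , 0)
arrowWt (NW _ _ _)   = (0 , 1 , 0 , 1)

data Path (a b c d N : ℕ) : ℕ → ℕ → Set where
  [] : ∀ {u} → Path a b c d N u u
  _∷_ : ∀ {u w v} → QArrow a b c d N u w → Path a b c d N w v → Path a b c d N u v

pathWt : ∀ {a b c d N u v} → Path a b c d N u v → Wt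
pathWt []                    = (0 , 0 , 0 , 0)
pathWt ((_ , _ , α) ∷ π)     = arrowWt α ⊕ pathWt π

module Submission where

-- Write up(λ) = aλ₁ + bλ₂ and down(λ) = cλ₃ + dλ₄, and call λ balanced from
-- u to v when up(λ) + u = down(λ) + v; the integer hypothesis of the theorem
-- says exactly that (l₁,l₂,l₃,l₄) is balanced from u to v.  Every arrow i → j
-- is balanced from i to j with its own weight, so after following an arrow α
-- whose weight is a summand of λ, the remaining weight is balanced from the
-- new vertex to v.  It therefore suffices to show that from a vertex u with a
-- nonzero balanced weight λ some arrow leaves u whose weight is a summand of
-- λ: if λ₁ > 0, take E when u + a ≤ N; otherwise take S (resp. N) when λ₃ > 0
-- (resp. λ₃ = 0 < λ₄) and u - c ≥ 1 (resp. u - d ≥ 1), else the wrap-around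
-- arrow SE (resp. NE); balance rules out λ₃ = λ₄ = 0 here.  The case λ₂ > 0
-- is symmetric, and if λ₁ = λ₂ = 0 balance forces u > c (resp. u > d), so S
-- (resp. N) applies.  Iterating while the size of the weight decreases gives
-- the path.

open import Defs
open import Data.Nat using (ℕ; zero; suc; _+_; _*_; _∸_; _≤_; _<_; s≤s; z≤n; s≤s⁻¹)
open import Data.Nat.Properties
  using ( ≤-refl; ≤-reflexive; ≤-trans; <⇒≤; ≤-<-trans; <-≤-trans; <-irrefl
        ; ≤-<-connex; <-≤-connex; +-comm; +-assoc; *-comm; +-cancelˡ-≡; +-identityʳ
        ; +-monoˡ-≤; m≤m+n; m≤n+m; m<m+n; m∸n≤m; m∸n+n≡m; m+n∸m≡n; ∸-monoˡ-≤
        ; m<n⇒0<n∸m )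
open import Data.Nat.Tactic.RingSolver using (solve-∀)
open import Data.Nat.GCD using (gcd)
open import Data.Integer using (ℤ; +_; _-_; 0ℤ) renaming (_+_ to _+ℤ_; _*_ to _*ℤ_)
open import Data.Integer.Properties using (pos-+; pos-*; +-injective; i≡j⇒i-j≡0; i-j≡0⇒i≡j)
import Data.Integer.Tactic.RingSolver as ℤSolver
open import Data.Product using (Σ; _×_; _,_; proj₁; proj₂)
open import Data.Sum using (_⊎_; inj₁; inj₂)
open import Data.Empty using (⊥; ⊥-elim)
open import Relation.Binary.PropositionalEquality using (_≡_; refl; sym; trans; cong; cong₂; module ≡-Reasoning)

open ≡-Reasoning

summands-≤ : ∀ {x y N} → x + y ≡ N → x ≤ N × y ≤ N
summands-≤ {x} {y} x+y≡N =
  ≤-trans (m≤m+n x y) (≤-reflexive x+y≡N) , ≤-trans (m≤n+m y x) (≤-reflexive x+y≡N)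

ascend : ∀ {N u x} → IsVertex N u → u + x ≤ N → IsVertex N (u + x)
ascend {u = u} {x} (1≤u , _) u+x≤N = ≤-trans 1≤u (m≤m+n u x) , u+x≤N

descend : ∀ {N u y} → y < u → u ≤ N → IsVertex N (u ∸ y)
descend {u = u} {y} y<u u≤N = m<n⇒0<n∸m y<u , ≤-trans (m∸n≤m u y) u≤N

wrap : ∀ {N u x y} → x ≤ N → y ≤ N → N < u + x → u ≤ y → IsVertex N (u + x ∸ y)
wrap {u = u} {x} {y} x≤N y≤N N<u+x u≤y =
  m<n⇒0<n∸m (≤-<-trans y≤N N<u+x) , ≤-trans at-most-x x≤N
  where
    at-most-x : u + x ∸ y ≤ x
    at-most-x = ≤-trans (∸-monoˡ-≤ y (+-monoˡ-≤ x u≤y)) (≤-reflexive (m+n∸m≡n y x))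

wrap-lands : ∀ {N u x y} → y ≤ N → N < u + x → u + x ∸ y + y ≡ u + x
wrap-lands y≤N N<u+x = m∸n+n≡m (≤-trans y≤N (<⇒≤ N<u+x))

no-overshoot : ∀ {N u v x P} → x ≤ P → P + u ≡ v → v ≤ N → N < u + x → ⊥
no-overshoot {N} {u} {x = x} x≤P P+u≡v v≤N N<u+x = <-irrefl refl (<-≤-trans N<u+x u+x≤N)
  where
    u+x≤N : u + x ≤ N
    u+x≤N = ≤-trans (≤-reflexive (+-comm u x))
              (≤-trans (+-monoˡ-≤ u x≤P) (≤-trans (≤-reflexive P+u≡v) v≤N))

forced-descent : ∀ {u v y Q} → y ≤ Q → 1 ≤ v → u ≡ Q + v → y < u
forced-descent {Q = Q} y≤Q 1≤v u≡Q+v =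
  <-≤-trans (≤-<-trans y≤Q (m<m+n Q 1≤v)) (≤-reflexive (sym u≡Q+v))

bilinear : ∀ x₁ x₂ y₁ y₂ p q → (x₁ + y₁) * p + (x₂ + y₂) * q ≡ (x₁ * p + x₂ * q) + (y₁ * p + y₂ * q)
bilinear = solve-∀

interchange : ∀ x₁ x₂ x₃ x₄ y₁ y₂ y₃ y₄ →
  (x₁ + y₁) + (x₂ + y₂) + (x₃ + y₃) + (x₄ + y₄) ≡ (x₁ + x₂ + x₃ + x₄) + (y₁ + y₂ + y₃ + y₄)
interchange = solve-∀

exchange : ∀ x y z → x + (y + z) ≡ y + (x + z)
exchange = solve-∀

unit₁ : ∀ x z → 1 * x + 0 * z ≡ x
unit₁ = solve-∀

unit₂ : ∀ z x → 0 * z + 1 * x ≡ x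
unit₂ = solve-∀

shifted : ∀ {p q x y i j} → p ≡ x → q ≡ y → j + y ≡ i + x → p + i ≡ q + j
shifted {p} {q} {x} {y} {i} {j} p≡x q≡y j+y≡i+x = begin
  p + i  ≡⟨ cong (_+ i) p≡x ⟩
  x + i  ≡⟨ +-comm x i ⟩
  i + x  ≡⟨ sym j+y≡i+x ⟩
  j + y  ≡⟨ +-comm j y ⟩
  y + j  ≡⟨ cong (_+ j) (sym q≡y) ⟩
  q + j  ∎

module Weights (a b c d : ℕ) where

  up : Wt → ℕ
  up (l₁ , l₂ , _ , _) = l₁ * a + l₂ * b

  down : Wt → ℕ
  down (_ , _ , l₃ , l₄) = l₃ * c + l₄ * d

  Balanced : ℕ → ℕ → Wt → Set
  Balanced u v μ = up μ + u ≡ down μ + v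

  size : Wt → ℕ
  size (l₁ , l₂ , l₃ , l₄) = l₁ + l₂ + l₃ + l₄

  up-⊕ : ∀ μ ν → up (μ ⊕ ν) ≡ up μ + up ν
  up-⊕ (x₁ , x₂ , _ , _) (y₁ , y₂ , _ , _) = bilinear x₁ x₂ y₁ y₂ a b

  down-⊕ : ∀ μ ν → down (μ ⊕ ν) ≡ down μ + down ν
  down-⊕ (_ , _ , x₃ , x₄) (_ , _ , y₃ , y₄) = bilinear x₃ x₄ y₃ y₄ c d

  size-⊕ : ∀ μ ν → size (μ ⊕ ν) ≡ size μ + size ν
  size-⊕ (x₁ , x₂ , x₃ , x₄) (y₁ , y₂ , y₃ , y₄) = interchange x₁ x₂ x₃ x₄ y₁ y₂ y₃ y₄

  arrow-balanced : ∀ {N i j} (α : Arrow a b c d N i j) → Balanced i j (arrowWt α)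
  arrow-balanced (E  j≡i+a)       = shifted {q = 0} (unit₁ a b) refl (trans (+-identityʳ _) j≡i+a)
  arrow-balanced (W  j≡i+b)       = shifted {q = 0} (unit₂ a b) refl (trans (+-identityʳ _) j≡i+b)
  arrow-balanced (S  j+c≡i)       = shifted {p = 0} refl (unit₁ c d) (trans j+c≡i (sym (+-identityʳ _)))
  arrow-balanced (Nn j+d≡i)       = shifted {p = 0} refl (unit₂ c d) (trans j+d≡i (sym (+-identityʳ _)))
  arrow-balanced (SE j+c≡i+a _ _) = shifted (unit₁ a b) (unit₁ c d) j+c≡i+a
  arrow-balanced (NE j+d≡i+a _ _) = shifted (unit₁ a b) (unit₂ c d) j+d≡i+a
  arrow-balanced (SW j+c≡i+b _ _) = shifted (unit₂ a b) (unit₁ c d) j+c≡i+b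
  arrow-balanced (NW j+d≡i+b _ _) = shifted (unit₂ a b) (unit₂ c d) j+d≡i+b

  rest-balanced : ∀ {u w v} μ ν → Balanced u w μ → Balanced u v (μ ⊕ ν) → Balanced w v ν
  rest-balanced {u} {w} {v} μ ν step whole = +-cancelˡ-≡ (down μ) _ _ (begin
    down μ + (up ν + w)     ≡⟨ exchange (down μ) (up ν) w ⟩
    up ν + (down μ + w)     ≡⟨ cong (_+_ (up ν)) (sym step) ⟩
    up ν + (up μ + u)       ≡⟨ exchange (up ν) (up μ) u ⟩
    up μ + (up ν + u)       ≡⟨ sym (+-assoc (up μ) (up ν) u) ⟩
    (up μ + up ν) + u       ≡⟨ cong (_+ u) (sym (up-⊕ μ ν)) ⟩
    up (μ ⊕ ν) + u          ≡⟨ whole ⟩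
    down (μ ⊕ ν) + v        ≡⟨ cong (_+ v) (down-⊕ μ ν) ⟩
    (down μ + down ν) + v   ≡⟨ +-assoc (down μ) (down ν) v ⟩
    down μ + (down ν + v)   ∎)

  arrow-size : ∀ {N i j} (α : Arrow a b c d N i j) → 1 ≤ size (arrowWt α)
  arrow-size (E _)      = s≤s z≤n
  arrow-size (W _)      = s≤s z≤n
  arrow-size (S _)      = s≤s z≤n
  arrow-size (Nn _)     = s≤s z≤n
  arrow-size (SE _ _ _) = s≤s z≤n
  arrow-size (NE _ _ _) = s≤s z≤n
  arrow-size (SW _ _ _) = s≤s z≤n
  arrow-size (NW _ _ _) = s≤s z≤n

  arrow-shrinks : ∀ {N i j} (α : Arrow a b c d N i j) ν → size ν < size (arrowWt α ⊕ ν)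
  arrow-shrinks α ν =
    ≤-trans (+-monoˡ-≤ (size ν) (arrow-size α)) (≤-reflexive (sym (size-⊕ (arrowWt α) ν)))

module Greedy (a b c d N : ℕ) (a≤N : a ≤ N) (b≤N : b ≤ N) (c≤N : c ≤ N) (d≤N : d ≤ N) where

  open Weights a b c d

  data Step (u : ℕ) (μ : Wt) : Set where
    step : ∀ {w} → IsVertex N w → (α : Arrow a b c d N u w) (ν : Wt) → μ ≡ arrowWt α ⊕ ν → Step u μ

  step-a : ∀ {u v} m l₂ l₃ l₄ → IsVertex N u → IsVertex N v →
           Balanced u v (suc m , l₂ , l₃ , l₄) → Step u (suc m , l₂ , l₃ , l₄)
  step-a {u} m l₂ l₃ l₄ u∈ v∈ bal with ≤-<-connex (u + a) N
  ... | inj₁ fits = step (ascend u∈ fits) (E refl) (m , l₂ , l₃ , l₄) refl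
  step-a {u} m l₂ (suc n) l₄ u∈ v∈ bal | inj₂ over with <-≤-connex c u
  ... | inj₁ c<u = step (descend c<u (proj₂ u∈)) (S (m∸n+n≡m (<⇒≤ c<u))) (suc m , l₂ , n , l₄) refl
  ... | inj₂ u≤c = step (wrap a≤N c≤N over u≤c) (SE (wrap-lands {x = a} c≤N over) over u≤c) (m , l₂ , n , l₄) refl
  step-a {u} m l₂ zero (suc n) u∈ v∈ bal | inj₂ over with <-≤-connex d u
  ... | inj₁ d<u = step (descend d<u (proj₂ u∈)) (Nn (m∸n+n≡m (<⇒≤ d<u))) (suc m , l₂ , zero , n) refl
  ... | inj₂ u≤d = step (wrap a≤N d≤N over u≤d) (NE (wrap-lands {x = a} d≤N over) over u≤d) (m , l₂ , zero , n) refl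
  step-a m l₂ zero zero u∈ v∈ bal | inj₂ over =
    ⊥-elim (no-overshoot (≤-trans (m≤m+n a (m * a)) (m≤m+n _ (l₂ * b))) bal (proj₂ v∈) over)

  step-b : ∀ {u v} m l₃ l₄ → IsVertex N u → IsVertex N v →
           Balanced u v (zero , suc m , l₃ , l₄) → Step u (zero , suc m , l₃ , l₄)
  step-b {u} m l₃ l₄ u∈ v∈ bal with ≤-<-connex (u + b) N
  ... | inj₁ fits = step (ascend u∈ fits) (W refl) (zero , m , l₃ , l₄) refl
  step-b {u} m (suc n) l₄ u∈ v∈ bal | inj₂ over with <-≤-connex c u
  ... | inj₁ c<u = step (descend c<u (proj₂ u∈)) (S (m∸n+n≡m (<⇒≤ c<u))) (zero , suc m , n , l₄) refl
  ... | inj₂ u≤c = step (wrap b≤N c≤N over u≤c) (SW (wrap-lands {x = b} c≤N over) over u≤c) (zero , m , n , l₄) refl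
  step-b {u} m zero (suc n) u∈ v∈ bal | inj₂ over with <-≤-connex d u
  ... | inj₁ d<u = step (descend d<u (proj₂ u∈)) (Nn (m∸n+n≡m (<⇒≤ d<u))) (zero , suc m , zero , n) refl
  ... | inj₂ u≤d = step (wrap b≤N d≤N over u≤d) (NW (wrap-lands {x = b} d≤N over) over u≤d) (zero , m , zero , n) refl
  step-b m zero zero u∈ v∈ bal | inj₂ over =
    ⊥-elim (no-overshoot (m≤m+n b (m * b)) bal (proj₂ v∈) over)

  next-step : ∀ {u v} μ → IsVertex N u → IsVertex N v → Balanced u v μ →
              (μ ≡ (0 , 0 , 0 , 0) × u ≡ v) ⊎ Step u μ
  next-step (zero , zero , zero , zero) _ _ u≡v = inj₁ (refl , u≡v)
  next-step (suc m , l₂ , l₃ , l₄) u∈ v∈ bal = inj₂ (step-a m l₂ l₃ l₄ u∈ v∈ bal)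
  next-step (zero , suc m , l₃ , l₄) u∈ v∈ bal = inj₂ (step-b m l₃ l₄ u∈ v∈ bal)
  next-step {u} (zero , zero , suc n , l₄) u∈ v∈ bal =
    inj₂ (step (descend c<u (proj₂ u∈)) (S (m∸n+n≡m (<⇒≤ c<u))) (zero , zero , n , l₄) refl)
    where
      c<u : c < u
      c<u = forced-descent (≤-trans (m≤m+n c (n * c)) (m≤m+n _ (l₄ * d))) (proj₁ v∈) bal
  next-step {u} (zero , zero , zero , suc n) u∈ v∈ bal =
    inj₂ (step (descend d<u (proj₂ u∈)) (Nn (m∸n+n≡m (<⇒≤ d<u))) (zero , zero , zero , n) refl)
    where
      d<u : d < u
      d<u = forced-descent (m≤m+n d (n * d)) (proj₁ v∈) bal

  walk : ∀ k {u v} μ → size μ < k → IsVertex N u → IsVertex N v → Balanced u v μ →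
         Σ (Path a b c d N u v) (λ π → pathWt π ≡ μ)
  walk zero μ () _ _ _
  walk (suc k) μ size<k u∈ v∈ bal with next-step μ u∈ v∈ bal
  ... | inj₁ (refl , refl) = [] , refl
  ... | inj₂ (step w∈ α ν refl)
    with walk k ν (<-≤-trans (arrow-shrinks α ν) (s≤s⁻¹ size<k)) w∈ v∈
              (rest-balanced (arrowWt α) ν (arrow-balanced α) bal)
  ...   | π , wt-π = (u∈ , w∈ , α) ∷ π , cong (arrowWt α ⊕_) wt-π

  path-of-weight : ∀ {u v} μ → IsVertex N u → IsVertex N v → Balanced u v μ →
                   Σ (Path a b c d N u v) (λ π → pathWt π ≡ μ)
  path-of-weight μ = walk (suc (size μ)) μ ≤-refl

embed : ∀ x l y m u → + (l * x + m * y + u) ≡ (+ x *ℤ + l) +ℤ (+ y *ℤ + m) +ℤ + u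
embed x l y m u = begin
  + (l * x + m * y + u)                 ≡⟨ cong (λ t → + (t + u)) (cong₂ _+_ (*-comm l x) (*-comm m y)) ⟩
  + (x * l + y * m + u)                 ≡⟨ pos-+ (x * l + y * m) u ⟩
  + (x * l + y * m) +ℤ + u              ≡⟨ cong (_+ℤ + u) (pos-+ (x * l) (y * m)) ⟩
  + (x * l) +ℤ + (y * m) +ℤ + u         ≡⟨ cong₂ (λ p q → p +ℤ q +ℤ + u) (pos-* x l) (pos-* y m) ⟩
  (+ x *ℤ + l) +ℤ (+ y *ℤ + m) +ℤ + u   ∎

regroup : ∀ A B C D U V → (A +ℤ B +ℤ U) - (C +ℤ D +ℤ V) ≡ (A +ℤ B - C - D) - (V - U)
regroup = ℤSolver.solve-∀

balanced-from-ℤ : ∀ a b c d u v l₁ l₂ l₃ l₄ →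
  (+ a *ℤ + l₁) +ℤ (+ b *ℤ + l₂) - (+ c *ℤ + l₃) - (+ d *ℤ + l₄) ≡ + v - + u →
  Weights.Balanced a b c d u v (l₁ , l₂ , l₃ , l₄)
balanced-from-ℤ a b c d u v l₁ l₂ l₃ l₄ eq = +-injective (i-j≡0⇒i≡j _ _ (begin
  + (l₁ * a + l₂ * b + u) - + (l₃ * c + l₄ * d + v)
    ≡⟨ cong₂ _-_ (embed a l₁ b l₂ u) (embed c l₃ d l₄ v) ⟩
  (A +ℤ B +ℤ + u) - (C +ℤ D +ℤ + v)  ≡⟨ regroup A B C D (+ u) (+ v) ⟩
  (A +ℤ B - C - D) - (+ v - + u)      ≡⟨ i≡j⇒i-j≡0 eq ⟩
  0ℤ                                 ∎))
  where
    A B C D : ℤ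
    A = + a *ℤ + l₁
    B = + b *ℤ + l₂
    C = + c *ℤ + l₃
    D = + d *ℤ + l₄

proposition3p1 : (a b c d N : ℕ) → 0 < a → 0 < b → 0 < c → 0 < d →
    a + b ≡ N → c + d ≡ N → gcd (gcd a c) N ≡ 1 →
    (u v : ℕ) → IsVertex N u → IsVertex N v →
    (l₁ l₂ l₃ l₄ : ℕ) →
    (+ a *ℤ + l₁) +ℤ (+ b *ℤ + l₂) - (+ c *ℤ + l₃) - (+ d *ℤ + l₄) ≡ + v - + u →
    Σ (Path a b c d N u v) (λ π → pathWt π ≡ (l₁ , l₂ , l₃ , l₄))
proposition3p1 a b c d N _ _ _ _ a+b≡N c+d≡N _ u v u∈ v∈ l₁ l₂ l₃ l₄ eq =
  Greedy.path-of-weight a b c d N a≤N b≤N c≤N d≤N (l₁ , l₂ , l₃ , l₄) u∈ v∈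
    (balanced-from-ℤ a b c d u v l₁ l₂ l₃ l₄ eq)
  where
    a≤N : a ≤ N
    a≤N = proj₁ (summands-≤ a+b≡N)
    b≤N : b ≤ N
    b≤N = proj₂ (summands-≤ a+b≡N)
    c≤N : c ≤ N
    c≤N = proj₁ (summands-≤ c+d≡N)
    d≤N : d ≤ N
    d≤N = proj₂ (summands-≤ c+d≡N)
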